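{- Let $t\ge 3$ be an integer, $G=(V,E)$ a simple undirected graph in which every vertex has degree at least $1$ and at most $t+1$, and $w:E\to\mathbb{R}_{\ge 0}$ a weight function that is vertex-induced on every $K_{t+1}$ and every $K_{t,t}$ of $G$. Assume that the forbidden subgraphs of $G$ (its $K_{t+1}$'s and $K_{t,t}$'s) are pairwise vertex-disjoint, and let $G'=(V',E')$, $w'$, $l$, $b$ be as constructed below. Then for every $(l,b)$-matching $M'$ of $G'$ there exists a covering co-$t$-matching $\bar M$ of $G$ with $w(\bar M)\le w'(M')$.
   Context: A "$K_{t+1}$ of $G$" (resp. "$K_{t,t}$ of $G$") is a subgraph of $G$, not necessarily induced, isomorphic to the complete graph on $t+1$ vertices (resp. to the complete bipartite graph with color classes $V_1(H),V_2(H)$ of size $t$). $w$ is vertex-induced on a subgraph $H$ if there is $r_H:V(H)\to\mathbb{R}$ (a potential function) with $w(u,v)=r_H(u)+r_H(v)$ for every edge $(u,v)$ of $H$. A set $\bar M\subseteq E$ is a co-$t$-matching if $E\setminus\bar M$ is a $t$-matching (every vertex incident to at most $t$ of its edges); it is covering if moreover $E\setminus\bar M$ contains the edge set of no $K_{t+1}$ and no $K_{t,t}$ of $G$. Construction: start with $G'=G$, $w'(e)=w(e)$ for $e\in E$; for each vertex $v$ of $G$ set the capacity interval $[l(v),b(v)]=[1,t+1]$ if $\deg_G(v)=t+1$ and $[0,\deg_G(v)]$ otherwise. For each $K_{t+1}$ $H$ of $G$, with a fixed potential function $r_H$, add a new vertex $u_H$ with capacity interval $[2,2]$ and, for each vertex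 $v$ of $H$, an edge $(v,u_H)$ of weight $r_H(v)$. For each $K_{t,t}$ $H$ of $G$, with a fixed potential function $r_H$, add new vertices $u^1_H,u^2_H$ with capacity intervals $[1,1]$, and edges $(v,u^i_H)$ of weight $r_H(v)$ for every $v\in V_i(H)$, $i=1,2$. An $(l,b)$-matching of $G'$ is a set $M'\subseteq E'$ with $l(v)\le \deg_{M'}(v)\le b(v)$ for all $v\in V'$; $w'(M')$ is the sum of weights of its edges.
   Formalization: The weight function $w$ and the potential functions $r_H$ take rational values rather than real ones. -}

module Defs where

open import Data.Bool using (Bool; true; false; _∧_; _∨_; not; if_then_else_; T)
open import Data.Nat using (ℕ; zero; suc; _≤_; _≡ᵇ_; _<ᵇ_)
open import Data.Fin using (Fin; toℕ) renaming (zero to fzero; suc to fsuc)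
open import Data.Fin.Subset using (Subset; _∪_; ∣_∣)
open import Data.List using (List; []; _∷_; _++_; map; concatMap; allFin)
open import Data.Vec using (Vec; []; _∷_; lookup)
open import Data.Rational using (ℚ; 0ℚ; _+_)
open import Data.Product using (_×_)
open import Data.Empty using (⊥)
open import Relation.Nullary using (¬_)
open import Relation.Nullary.Decidable using (⌊_⌋)
open import Relation.Binary.PropositionalEquality using (_≡_; _≢_)
import Data.Fin as F

allL : {A : Set} → List A → (A → Bool) → Bool
allL []       p = true
allL (x ∷ xs) p = p x ∧ allL xs p

anyL : {A : Set} → List A → (A → Bool) → Bool
anyL []       p = false
anyL (x ∷ xs) p = p x ∨ anyL xs p

countL : {A : Set} → List A → (A → Bool) → ℕ
countL []       p = 0
countL (x ∷ xs) p = if p x then suc (countL xs p) else countL xs p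

sumL : {A : Set} → List A → (A → ℚ) → ℚ
sumL []       f = 0ℚ
sumL (x ∷ xs) f = f x + sumL xs f

pairSum : {A : Set} → List A → (A → A → ℚ) → ℚ
pairSum []       f = 0ℚ
pairSum (x ∷ xs) f = sumL xs (f x) + pairSum xs f

allSubsets : (n : ℕ) → List (Subset n)
allSubsets zero    = [] ∷ []
allSubsets (suc n) = map (false ∷_) (allSubsets n) ++ map (true ∷_) (allSubsets n)

_∈ᵇ_ : {n : ℕ} → Fin n → Subset n → Bool
v ∈ᵇ S = lookup S v

_≟ᵇ_ : {n : ℕ} → Fin n → Fin n → Bool
u ≟ᵇ v = ⌊ u F.≟ v ⌋

record Graph (n : ℕ) : Set where
  field
    adj     : Fin n → Fin n → Bool
    adj-sym : ∀ u v → adj u v ≡ adj v u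
    adj-irr : ∀ v → adj v v ≡ false
open Graph public

deg : {n : ℕ} → Graph n → Fin n → ℕ
deg {n} G v = countL (allFin n) (adj G v)

record EdgeSet {n : ℕ} (G : Graph n) (M : Fin n → Fin n → Bool) : Set where
  field
    sym : ∀ u v → M u v ≡ M v u
    sub : ∀ u v → T (M u v) → T (adj G u v)

-- total weight w(M) of an edge set (each unordered edge counted once)
weight : {n : ℕ} → (Fin n → Fin n → ℚ) → (Fin n → Fin n → Bool) → ℚ
weight {n} w M = pairSum (allFin n) (λ u v → if M u v then w u v else 0ℚ)

-- A K_{t,t} of G is given by its
-- ordered pair of colour classes (A , B) with |A| = |B| = t, A ∩ B = ∅,
-- all A–B pairs adjacent; to count each (unordered) K_{t,t} once we use
-- the canonical orientation in which the smallest vertex of A ∪ B is in A.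

module Forbidden {n : ℕ} (t : ℕ) (G : Graph n) where

  isK : Subset n → Bool
  isK S = (∣ S ∣ ≡ᵇ suc t)
        ∧ allL (allFin n) (λ u → allL (allFin n) (λ v →
            not (u ∈ᵇ S ∧ v ∈ᵇ S ∧ not (u ≟ᵇ v)) ∨ adj G u v))

  isKtt : Subset n → Subset n → Bool
  isKtt A B = (∣ A ∣ ≡ᵇ t) ∧ (∣ B ∣ ≡ᵇ t)
        ∧ allL (allFin n) (λ v → not (v ∈ᵇ A ∧ v ∈ᵇ B))
        ∧ allL (allFin n) (λ u → allL (allFin n) (λ v →
            not (u ∈ᵇ A ∧ v ∈ᵇ B) ∨ adj G u v))
        ∧ allL (allFin n) (λ v → not (v ∈ᵇ B) ∨
            anyL (allFin n) (λ u → u ∈ᵇ A ∧ (toℕ u <ᵇ toℕ v)))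

  side : Subset n → Subset n → Fin 2 → Subset n
  side A B fzero     = A
  side A B (fsuc _)  = B

  Disjoint : Subset n → Subset n → Set
  Disjoint S S' = ∀ v → T (v ∈ᵇ S) → T (v ∈ᵇ S') → ⊥

  record PairwiseDisjoint : Set where
    field
      KK : ∀ S S' → T (isK S) → T (isK S') → S ≢ S' → Disjoint S S'
      BB : ∀ A B A' B' → T (isKtt A B) → T (isKtt A' B') →
           ¬ (A ≡ A' × B ≡ B') → Disjoint (A ∪ B) (A' ∪ B')
      KB : ∀ S A B → T (isK S) → T (isKtt A B) → Disjoint S (A ∪ B)

  IsPotentialK : (Fin n → Fin n → ℚ) → Subset n → (Fin n → ℚ) → Set
  IsPotentialK w S r = ∀ u v → T (u ∈ᵇ S) → T (v ∈ᵇ S) → u ≢ v →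
                       w u v ≡ r u + r v

  IsPotentialB : (Fin n → Fin n → ℚ) → Subset n → Subset n → (Fin n → ℚ) → Set
  IsPotentialB w A B r = ∀ u v → T (u ∈ᵇ A) → T (v ∈ᵇ B) → w u v ≡ r u + r v

  record IsCoveringCoTMatching (Mbar : Fin n → Fin n → Bool) : Set where
    N : Fin n → Fin n → Bool
    N u v = adj G u v ∧ not (Mbar u v)
    field
      edges    : EdgeSet G Mbar
      tmatch   : ∀ v → countL (allFin n) (N v) ≤ t
      noK      : ∀ S → T (isK S) →
                 ¬ (∀ u v → T (u ∈ᵇ S) → T (v ∈ᵇ S) → u ≢ v → T (N u v))
      noKtt    : ∀ A B → T (isKtt A B) →
                 ¬ (∀ u v → T (u ∈ᵇ A) → T (v ∈ᵇ B) → T (N u v))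

-- Gadget vertices attached to non-forbidden
-- subsets are isolated and get capacity [0,0]; they do not affect the
-- set of (l,b)-matchings.

data V' (n : ℕ) : Set where
  orig : Fin n → V' n
  uK   : Subset n → V' n
  uB   : Subset n → Subset n → Fin 2 → V' n

allV' : (n : ℕ) → List (V' n)
allV' n = map orig (allFin n)
       ++ map uK (allSubsets n)
       ++ concatMap (λ A → concatMap (λ B → map (uB A B) (allFin 2))
                                     (allSubsets n)) (allSubsets n)

module Construction {n : ℕ} (t : ℕ) (G : Graph n) (w : Fin n → Fin n → ℚ)
                    (rK : Subset n → Fin n → ℚ)
                    (rB : Subset n → Subset n → Fin n → ℚ) where
  open Forbidden t G

  adj' : V' n → V' n → Bool
  adj' (orig u)     (orig v)     = adj G u v
  adj' (orig v)     (uK S)       = isK S ∧ v ∈ᵇ S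
  adj' (uK S)       (orig v)     = isK S ∧ v ∈ᵇ S
  adj' (orig v)     (uB A B i)   = isKtt A B ∧ v ∈ᵇ side A B i
  adj' (uB A B i)   (orig v)     = isKtt A B ∧ v ∈ᵇ side A B i
  adj' _            _            = false

  w' : V' n → V' n → ℚ
  w' (orig u)     (orig v)     = w u v
  w' (orig v)     (uK S)       = rK S v
  w' (uK S)       (orig v)     = rK S v
  w' (orig v)     (uB A B i)   = rB A B v
  w' (uB A B i)   (orig v)     = rB A B v
  w' _            _            = 0ℚ

  l b : V' n → ℕ
  l (orig v)     = if deg G v ≡ᵇ suc t then 1 else 0
  l (uK S)       = if isK S then 2 else 0
  l (uB A B i)   = if isKtt A B then 1 else 0
  b (orig v)     = if deg G v ≡ᵇ suc t then suc t else deg G v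
  b (uK S)       = if isK S then 2 else 0
  b (uB A B i)   = if isKtt A B then 1 else 0

  deg' : (V' n → V' n → Bool) → V' n → ℕ
  deg' M x = countL (allV' n) (M x)

  record IsLBMatching (M : V' n → V' n → Bool) : Set where
    field
      sym   : ∀ x y → M x y ≡ M y x
      sub   : ∀ x y → T (M x y) → T (adj' x y)
      lower : ∀ x → l x ≤ deg' M x
      upper : ∀ x → deg' M x ≤ b x

  weight' : (V' n → V' n → Bool) → ℚ
  weight' M = pairSum (allV' n) (λ x y → if M x y then w' x y else 0ℚ)

-- Given an (l,b)-matching M' of G', take for M̄ the G-edges of M', together with, for every
-- forbidden subgraph H, the edge of H joining the two vertices that M' matches to its gadget
-- vertex u_H (resp. to u¹_H and u²_H); the gadget capacities are exact, so such an edge exists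
-- in every H. A vertex of degree t+1 has lower capacity 1, so it is matched somewhere and thereby
-- receives an M̄-edge; hence at most t of its edges lie outside M̄. Because w is vertex-induced
-- on H, the weight r_H(u) + r_H(v) of the M̄-edge uv chosen in H is exactly the w'-weight of the
-- two M'-edges at the gadget of H, so summing over edges (with w ≥ 0 absorbing overlaps) gives
-- w(M̄) ≤ w'(M').

{-# OPTIONS --safe #-}
module Submission where

open import Defs
open import Algebra.Bundles using (CommutativeMonoid)
open import Data.Bool using (Bool; true; false; T; _∧_; _∨_; not; if_then_else_)
open import Data.Bool.Properties
  using (T-≡; T-∧; T-∨; ∧-comm; ∧-zeroʳ; ∧-identityʳ; ∨-identityʳ; ∨-comm; if-eta; if-cong)
open import Data.Empty using (⊥; ⊥-elim)
open import Data.Fin using (Fin) renaming (zero to fzero; suc to fsuc)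
import Data.Fin as Fin
open import Data.Fin.Subset using (Subset; ∣_∣)
open import Data.List using (List; []; _∷_; _++_; map; concatMap; allFin)
open import Data.List.Membership.Propositional using (_∈_)
open import Data.List.Membership.Propositional.Properties using (∈-allFin; ∈-map⁺; ∈-++⁺ˡ; ∈-++⁺ʳ)
open import Data.List.Relation.Unary.All as All using (All; []; _∷_)
open import Data.List.Relation.Unary.All.Properties using (++⁺; map⁺; concat⁺)
open import Data.List.Relation.Unary.AllPairs using ([]; _∷_)
open import Data.List.Relation.Unary.Any using (here; there)
open import Data.List.Relation.Unary.Unique.Propositional using (Unique)
open import Data.List.Relation.Unary.Unique.Propositional.Properties using (allFin⁺)
open import Data.Maybe using (nothing)
open import Data.Nat using (ℕ; zero; suc; z≤n; s≤s; _≤_; _<_; _≡ᵇ_)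
import Data.Nat.Properties as ℕ
open import Data.Product using (Σ; _×_; _,_; proj₁; proj₂)
open import Data.Rational using (ℚ; 0ℚ; _+_) renaming (_≤_ to _≤ℚ_)
import Data.Rational.Properties as ℚ
open import Data.Sum using (_⊎_; inj₁; inj₂; [_,_]′)
open import Data.Unit using (⊤; tt)
open import Data.Vec using ([]; _∷_)
open import Function using (_∘_; Equivalence)
open import Relation.Binary.Definitions using (DecidableEquality)
open import Relation.Binary.PropositionalEquality hiding ([_])
open import Relation.Nullary using (¬_; yes; no)
open import Relation.Nullary.Decidable using (T?; fromWitnessFalse)
open import Tactic.RingSolver using (solve-∀)
open import Tactic.RingSolver.Core.AlmostCommutativeRing using (AlmostCommutativeRing; fromCommutativeRing)

open import Algebra.Properties.CommutativeMonoid.Mult ℚ.+-0-commutativeMonoid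
  using (×-distrib-+; ×-homo-1) renaming (_×_ to _·_)
open import Algebra.Properties.CommutativeSemigroup
  (CommutativeMonoid.commutativeSemigroup ℚ.+-0-commutativeMonoid) using (interchange; x∙yz≈y∙xz)
open import Algebra.Properties.Group ℚ.+-0-group using (∙-cancelʳ)
open Equivalence using (to; from)

private
  variable
    A B : Set
    P : A → Set

ℚ-ring : AlmostCommutativeRing _ _
ℚ-ring = fromCommutativeRing ℚ.+-*-commutativeRing (λ _ → nothing)

if-true : ∀ {b} {x y : A} → T b → (if b then x else y) ≡ x
if-true {b = true} _ = refl

if-false : ∀ {b} {x y : A} → ¬ T b → (if b then x else y) ≡ y
if-false {b = true}  ¬b = ⊥-elim (¬b _)
if-false {b = false} _  = refl

if-then-cong : ∀ b {x y z : A} → (T b → x ≡ y) → (if b then x else z) ≡ (if b then y else z)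
if-then-cong true  x≡y = x≡y _
if-then-cong false _   = refl

T-∧-head : ∀ a {b} → T (a ∧ b) → T a
T-∧-head true _ = _

T-∧-tail : ∀ a {b} → T (a ∧ b) → T b
T-∧-tail true h = h

T-∨-inj₂ : ∀ a {b} → T b → T (a ∨ b)
T-∨-inj₂ true  _ = _
T-∨-inj₂ false h = h

T-not-¬ : ∀ {b} → T (not b) → ¬ T b
T-not-¬ {false} _ ()

T-implies : ∀ {a b} → T (not a ∨ b) → T a → T b
T-implies {true} b _ = b

anyL-intro : ∀ {xs : List A} {p x} → x ∈ xs → T (p x) → T (anyL xs p)
anyL-intro (here refl) px = from T-∨ (inj₁ px)
anyL-intro (there x∈)  px = from T-∨ (inj₂ (anyL-intro x∈ px))

anyL-cong : ∀ (xs : List A) {p q} → (∀ x → p x ≡ q x) → anyL xs p ≡ anyL xs q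
anyL-cong []       p≡q = refl
anyL-cong (x ∷ xs) p≡q = cong₂ _∨_ (p≡q x) (anyL-cong xs p≡q)

allL-elim : ∀ {xs : List A} {p x} → T (allL xs p) → x ∈ xs → T (p x)
allL-elim h (here refl) = proj₁ (to T-∧ h)
allL-elim h (there x∈)  = allL-elim (proj₂ (to T-∧ h)) x∈

countL-mono : ∀ (xs : List A) {p q} → (∀ x → T (p x) → T (q x)) → countL xs p ≤ countL xs q
countL-mono []       p⇒q = z≤n
countL-mono (x ∷ xs) {p} {q} p⇒q with p x in px | q x in qx
... | true  | true  = s≤s (countL-mono xs p⇒q)
... | true  | false = ⊥-elim (subst T qx (p⇒q x (from T-≡ px)))
... | false | true  = ℕ.m≤n⇒m≤1+n (countL-mono xs p⇒q)
... | false | false = countL-mono xs p⇒q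

countL-< : ∀ (xs : List A) {p q y} → (∀ x → T (p x) → T (q x)) →
           y ∈ xs → ¬ T (p y) → T (q y) → countL xs p < countL xs q
countL-< (x ∷ xs) {p} {q} p⇒q (here refl) ¬py qy
  rewrite if-false {x = suc (countL xs p)} {y = countL xs p} ¬py
        | if-true  {x = suc (countL xs q)} {y = countL xs q} qy
  = s≤s (countL-mono xs p⇒q)
countL-< (x ∷ xs) {p} {q} p⇒q (there y∈) ¬py qy with p x in px | q x in qx
... | true  | true  = s≤s (countL-< xs p⇒q y∈ ¬py qy)
... | true  | false = ⊥-elim (subst T qx (p⇒q x (from T-≡ px)))
... | false | true  = ℕ.m≤n⇒m≤1+n (countL-< xs p⇒q y∈ ¬py qy)
... | false | false = countL-< xs p⇒q y∈ ¬py qy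

countL-witness : ∀ (xs : List A) {p} → 1 ≤ countL xs p → Σ A (λ x → x ∈ xs × T (p x))
countL-witness (x ∷ xs) {p} c≥1 with p x in px
... | true  = x , here refl , from T-≡ px
... | false with countL-witness xs c≥1
...   | y , y∈ , py = y , there y∈ , py

countL-witness-≢ : DecidableEquality A → ∀ {xs : List A} {p} → Unique xs →
                   2 ≤ countL xs p → ∀ z → Σ A (λ x → T (p x) × x ≢ z)
countL-witness-≢ _≟_ {xs = x ∷ xs} {p} (x∉xs ∷ unique) c≥2 z with p x in px
... | false = countL-witness-≢ _≟_ unique c≥2 z
... | true with x ≟ z
...   | no x≢z = x , from T-≡ px , x≢z
...   | yes refl with countL-witness xs (ℕ.≤-pred c≥2)
...     | y , y∈ , py = y , py , λ y≡x → All.lookup x∉xs y∈ (sym y≡x)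

countL-map : ∀ (f : A → B) (xs : List A) {p} → countL (map f xs) p ≡ countL xs (p ∘ f)
countL-map f []       = refl
countL-map f (x ∷ xs) {p} with p (f x)
... | true  = cong suc (countL-map f xs)
... | false = countL-map f xs

countL-cong : ∀ (xs : List A) {p q} → (∀ x → p x ≡ q x) → countL xs p ≡ countL xs q
countL-cong []       p≡q = refl
countL-cong (x ∷ xs) {p} {q} p≡q rewrite p≡q x with q x
... | true  = cong suc (countL-cong xs p≡q)
... | false = countL-cong xs p≡q

countL-none : ∀ {xs : List A} {p} → All (λ x → ¬ T (p x)) xs → countL xs p ≡ 0
countL-none []                          = refl
countL-none {xs = x ∷ xs} {p} (¬px ∷ none)
  rewrite if-false {x = suc (countL xs p)} {y = countL xs p} ¬px = countL-none none

countL-++-none : ∀ (xs : List A) {ys p} → All (λ y → ¬ T (p y)) ys →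
                 countL (xs ++ ys) p ≡ countL xs p
countL-++-none []       none = countL-none none
countL-++-none (x ∷ xs) {p = p} none with p x
... | true  = cong suc (countL-++-none xs none)
... | false = countL-++-none xs none

∨-∧-false : ∀ a b → (a ∨ b ∧ false) ≡ a
∨-∧-false a b = trans (cong (a ∨_) (∧-zeroʳ b)) (∨-identityʳ a)

sumWhere : List A → (A → Bool) → (A → ℚ) → ℚ
sumWhere xs p r = sumL xs (λ x → if p x then r x else 0ℚ)

sumL-cong : ∀ (xs : List A) {f g} → (∀ x → f x ≡ g x) → sumL xs f ≡ sumL xs g
sumL-cong []       f≡g = refl
sumL-cong (x ∷ xs) f≡g = cong₂ _+_ (f≡g x) (sumL-cong xs f≡g)

sumL-zero : ∀ (xs : List A) {f} → (∀ x → f x ≡ 0ℚ) → sumL xs f ≡ 0ℚ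
sumL-zero xs f≡0 = trans (sumL-cong xs f≡0) (go xs)
  where
  go : ∀ (xs : List A) → sumL xs (λ _ → 0ℚ) ≡ 0ℚ
  go []       = refl
  go (x ∷ xs) = trans (ℚ.+-identityˡ _) (go xs)

sumL-mono : ∀ (xs : List A) {f g} → (∀ x → f x ≤ℚ g x) → sumL xs f ≤ℚ sumL xs g
sumL-mono []       f≤g = ℚ.≤-refl
sumL-mono (x ∷ xs) f≤g = ℚ.+-mono-≤ (f≤g x) (sumL-mono xs f≤g)

sumL-++ : ∀ (xs ys : List A) f → sumL (xs ++ ys) f ≡ sumL xs f + sumL ys f
sumL-++ []       ys f = sym (ℚ.+-identityˡ _)
sumL-++ (x ∷ xs) ys f = trans (cong (f x +_) (sumL-++ xs ys f)) (sym (ℚ.+-assoc (f x) _ _))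

sumL-map : ∀ (g : A → B) (xs : List A) f → sumL (map g xs) f ≡ sumL xs (f ∘ g)
sumL-map g []       f = refl
sumL-map g (x ∷ xs) f = cong (f (g x) +_) (sumL-map g xs f)

sumL-concatMap : ∀ (g : A → List B) (xs : List A) f →
                 sumL (concatMap g xs) f ≡ sumL xs (λ x → sumL (g x) f)
sumL-concatMap g []       f = refl
sumL-concatMap g (x ∷ xs) f =
  trans (sumL-++ (g x) (concatMap g xs) f) (cong (sumL (g x) f +_) (sumL-concatMap g xs f))

sumL-+ : ∀ (xs : List A) f g → sumL xs (λ x → f x + g x) ≡ sumL xs f + sumL xs g
sumL-+ []       f g = sym (ℚ.+-identityˡ 0ℚ)
sumL-+ (x ∷ xs) f g = trans (cong (f x + g x +_) (sumL-+ xs f g)) (interchange (f x) (g x) _ _)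

sumL-swap : ∀ (xs : List A) (ys : List B) (f : A → B → ℚ) →
            sumL xs (λ x → sumL ys (f x)) ≡ sumL ys (λ y → sumL xs (λ x → f x y))
sumL-swap []       ys f = sym (sumL-zero ys (λ _ → refl))
sumL-swap (x ∷ xs) ys f =
  trans (cong (sumL ys (f x) +_) (sumL-swap xs ys f)) (sym (sumL-+ ys (f x) _))

if-∨-≤ : ∀ a b {q} → 0ℚ ≤ℚ q →
         (if a ∨ b then q else 0ℚ) ≤ℚ (if a then q else 0ℚ) + (if b then q else 0ℚ)
if-∨-≤ true  true  {q} q≥0 = subst (_≤ℚ q + q) (ℚ.+-identityʳ q) (ℚ.+-monoʳ-≤ q q≥0)
if-∨-≤ true  false {q} q≥0 = ℚ.≤-reflexive (sym (ℚ.+-identityʳ q))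
if-∨-≤ false b         q≥0 = ℚ.≤-reflexive (sym (ℚ.+-identityˡ _))

if-anyL-≤ : ∀ (xs : List A) p {q} → 0ℚ ≤ℚ q →
            (if anyL xs p then q else 0ℚ) ≤ℚ sumWhere xs p (λ _ → q)
if-anyL-≤ []       p     q≥0 = ℚ.≤-refl
if-anyL-≤ (x ∷ xs) p {q} q≥0 = ℚ.≤-trans (if-∨-≤ (p x) (anyL xs p) q≥0)
                                  (ℚ.+-monoʳ-≤ (if p x then q else 0ℚ) (if-anyL-≤ xs p q≥0))

pairSum-cong : ∀ {xs : List A} {f g} → Unique xs →
               (∀ u v → u ≢ v → f u v ≡ g u v) → pairSum xs f ≡ pairSum xs g
pairSum-cong                   []                f≡g = refl
pairSum-cong {xs = x ∷ xs} {f} {g} (x∉xs ∷ unique) f≡g =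
  cong₂ _+_ (row x∉xs) (pairSum-cong unique f≡g)
  where
  row : ∀ {ys} → All (x ≢_) ys → sumL ys (f x) ≡ sumL ys (g x)
  row []             = refl
  row (x≢y ∷ x≢ys) = cong₂ _+_ (f≡g x _ x≢y) (row x≢ys)

pairSum-mono : ∀ (xs : List A) {f g} → (∀ u v → f u v ≤ℚ g u v) → pairSum xs f ≤ℚ pairSum xs g
pairSum-mono []       f≤g = ℚ.≤-refl
pairSum-mono (x ∷ xs) f≤g = ℚ.+-mono-≤ (sumL-mono xs (f≤g x)) (pairSum-mono xs f≤g)

pairSum-zero : ∀ {xs : List A} {f} → All P xs →
               (∀ {u v} → P u → P v → f u v ≡ 0ℚ) → pairSum xs f ≡ 0ℚ
pairSum-zero                  []         f≡0 = refl
pairSum-zero {P = Q} {xs = x ∷ xs} {f} (px ∷ pxs) f≡0 =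
  trans (cong₂ _+_ (row pxs) (pairSum-zero pxs f≡0)) (ℚ.+-identityˡ 0ℚ)
  where
  row : ∀ {ys} → All Q ys → sumL ys (f x) ≡ 0ℚ
  row []         = refl
  row (py ∷ pys) = trans (cong₂ _+_ (f≡0 px py) (row pys)) (ℚ.+-identityˡ 0ℚ)

pairSum-+ : ∀ (xs : List A) f g → pairSum xs (λ u v → f u v + g u v) ≡ pairSum xs f + pairSum xs g
pairSum-+ []       f g = sym (ℚ.+-identityˡ 0ℚ)
pairSum-+ (x ∷ xs) f g =
  trans (cong₂ _+_ (sumL-+ xs (f x) (g x)) (pairSum-+ xs f g))
        (interchange (sumL xs (f x)) (sumL xs (g x)) (pairSum xs f) (pairSum xs g))

pairSum-sumL : ∀ (xs : List A) (ks : List B) (f : B → A → A → ℚ) →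
               pairSum xs (λ u v → sumL ks (λ k → f k u v)) ≡ sumL ks (λ k → pairSum xs (f k))
pairSum-sumL []       ks f = sym (sumL-zero ks (λ _ → refl))
pairSum-sumL (x ∷ xs) ks f =
  trans (cong₂ _+_ (sumL-swap xs ks (λ v k → f k x v)) (pairSum-sumL xs ks f))
        (sym (sumL-+ ks (λ k → sumL xs (f k x)) (λ k → pairSum xs (f k))))

pairSum-map : ∀ (g : A → B) (xs : List A) f →
              pairSum (map g xs) f ≡ pairSum xs (λ u v → f (g u) (g v))
pairSum-map g []       f = refl
pairSum-map g (x ∷ xs) f = cong₂ _+_ (sumL-map g xs (f (g x))) (pairSum-map g xs f)

pairSum-++ : ∀ (xs ys : List A) f →
             pairSum (xs ++ ys) f ≡ pairSum xs f + (sumL xs (λ x → sumL ys (f x)) + pairSum ys f)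
pairSum-++ []       ys f = sym (trans (ℚ.+-identityˡ _) (ℚ.+-identityˡ _))
pairSum-++ (x ∷ xs) ys f =
  trans (cong₂ _+_ (sumL-++ xs ys (f x)) (pairSum-++ xs ys f))
        (regroup (sumL xs (f x)) (sumL ys (f x)) (pairSum xs f)
                 (sumL xs (λ z → sumL ys (f z))) (pairSum ys f))
  where
  regroup : ∀ a b c d e → (a + b) + (c + (d + e)) ≡ (a + c) + ((b + d) + e)
  regroup = solve-∀ ℚ-ring

sumWhere-+ : ∀ (xs : List A) p a r →
             sumWhere xs p (λ x → a + r x) ≡ countL xs p · a + sumWhere xs p r
sumWhere-+ []       p a r = sym (ℚ.+-identityˡ 0ℚ)
sumWhere-+ (x ∷ xs) p a r with p x
... | true  = trans (cong (a + r x +_) (sumWhere-+ xs p a r)) (interchange a (r x) _ _)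
... | false = trans (cong (0ℚ +_) (sumWhere-+ xs p a r))
                    (x∙yz≈y∙xz 0ℚ (countL xs p · a) (sumWhere xs p r))

module _ (p : A → Bool) (r : A → ℚ) where
  private
    cliquePairs : List A → ℚ
    cliquePairs xs = pairSum xs (λ u v → if p u ∧ p v then r u + r v else 0ℚ)

  -- Each element of a clique of size c lies on c - 1 of its pairs, so the pair sum is
  -- (c - 1) · Σ r; the statement avoids the subtraction.
  pairSum-clique : ∀ (xs : List A) →
                   pairSum xs (λ u v → if p u ∧ p v then r u + r v else 0ℚ) + sumWhere xs p r
                   ≡ countL xs p · sumWhere xs p r
  pairSum-clique []       = ℚ.+-identityˡ 0ℚ
  pairSum-clique (x ∷ xs) with p x
  ... | true  = begin
      (sumWhere xs p (λ v → r x + r v) + cliquePairs xs) + (r x + S)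
    ≡⟨ cong (λ s → (s + cliquePairs xs) + (r x + S)) (sumWhere-+ xs p (r x) r) ⟩
      ((c · r x + S) + cliquePairs xs) + (r x + S)
    ≡⟨ regroup (c · r x) S (cliquePairs xs) (r x) ⟩
      (r x + S) + (c · r x + (cliquePairs xs + S))
    ≡⟨ cong (λ s → (r x + S) + (c · r x + s)) (pairSum-clique xs) ⟩
      (r x + S) + (c · r x + c · S)
    ≡⟨ cong (r x + S +_) (sym (×-distrib-+ (r x) S c)) ⟩
      (r x + S) + c · (r x + S) ∎
    where
    open ≡-Reasoning
    S = sumWhere xs p r
    c = countL xs p
    regroup : ∀ a s π d → ((a + s) + π) + (d + s) ≡ (d + s) + (a + (π + s))
    regroup = solve-∀ ℚ-ring
  ... | false = begin
      (sumL xs (λ _ → 0ℚ) + cliquePairs xs) + (0ℚ + S)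
    ≡⟨ cong₂ (λ a b → (a + cliquePairs xs) + b) (sumL-zero xs (λ _ → refl)) (ℚ.+-identityˡ S) ⟩
      (0ℚ + cliquePairs xs) + S
    ≡⟨ cong (_+ S) (ℚ.+-identityˡ (cliquePairs xs)) ⟩
      cliquePairs xs + S
    ≡⟨ pairSum-clique xs ⟩
      countL xs p · S
    ≡⟨ cong (countL xs p ·_) (sym (ℚ.+-identityˡ S)) ⟩
      countL xs p · (0ℚ + S) ∎
    where
    open ≡-Reasoning
    S = sumWhere xs p r

  pairSum-clique₂ : ∀ (xs : List A) → countL xs p ≡ 2 →
                    pairSum xs (λ u v → if p u ∧ p v then r u + r v else 0ℚ) ≡ sumWhere xs p r
  pairSum-clique₂ xs c≡2 = ∙-cancelʳ S (cliquePairs xs) S (begin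
      cliquePairs xs + S ≡⟨ pairSum-clique xs ⟩
      countL xs p · S    ≡⟨ cong (_· S) c≡2 ⟩
      S + (S + 0ℚ)       ≡⟨ cong (S +_) (ℚ.+-identityʳ S) ⟩
      S + S              ∎)
    where
    open ≡-Reasoning
    S = sumWhere xs p r

across : (A → Bool) → (A → Bool) → A → A → Bool
across p q u v = p u ∧ q v ∨ p v ∧ q u

across-sym : ∀ (p q : A → Bool) u v → across p q u v ≡ across p q v u
across-sym p q u v = ∨-comm (p u ∧ q v) (p v ∧ q u)

across-cases : ∀ (p q : A → Bool) u v → T (across p q u v) →
               (T (p u) × T (q v)) ⊎ (T (p v) × T (q u))
across-cases p q u v h with p u ∧ q v in e
... | true  = inj₁ (to T-∧ (from T-≡ e))
... | false = inj₂ (to T-∧ h)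

module _ (p q : A → Bool) (r : A → ℚ) (disjoint : ∀ x → T (p x) → ¬ T (q x)) where
  private
    Sp Sq : List A → ℚ
    Sp xs = sumWhere xs p r
    Sq xs = sumWhere xs q r

    crossPairs : List A → ℚ
    crossPairs xs = pairSum xs (λ u v → if across p q u v then r u + r v else 0ℚ)

  pairSum-biclique : ∀ (xs : List A) →
                     pairSum xs (λ u v → if across p q u v then r u + r v else 0ℚ)
                     ≡ countL xs q · sumWhere xs p r + countL xs p · sumWhere xs q r
  pairSum-biclique []       = sym (ℚ.+-identityˡ 0ℚ)
  pairSum-biclique (x ∷ xs) with p x in px | q x in qx
  ... | true  | true  = ⊥-elim (disjoint x (from T-≡ px) (from T-≡ qx))
  ... | true  | false = begin
      sumL xs (λ v → if q v ∨ p v ∧ false then r x + r v else 0ℚ) + crossPairs xs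
    ≡⟨ cong₂ _+_ (sumL-cong xs (λ v → if-cong (∨-∧-false (q v) (p v))))
                 (pairSum-biclique xs) ⟩
      sumWhere xs q (λ v → r x + r v) + (cq · Sp xs + cp · Sq xs)
    ≡⟨ cong (_+ (cq · Sp xs + cp · Sq xs)) (sumWhere-+ xs q (r x) r) ⟩
      (cq · r x + Sq xs) + (cq · Sp xs + cp · Sq xs)
    ≡⟨ interchange (cq · r x) (Sq xs) (cq · Sp xs) (cp · Sq xs) ⟩
      (cq · r x + cq · Sp xs) + (Sq xs + cp · Sq xs)
    ≡⟨ cong₂ _+_ (sym (×-distrib-+ (r x) (Sp xs) cq))
                 (cong (λ s → s + cp · s) (sym (ℚ.+-identityˡ (Sq xs)))) ⟩
      cq · (r x + Sp xs) + ((0ℚ + Sq xs) + cp · (0ℚ + Sq xs)) ∎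
    where
    open ≡-Reasoning
    cp = countL xs p
    cq = countL xs q
  ... | false | true  = begin
      sumL xs (λ v → if p v ∧ true then r x + r v else 0ℚ) + crossPairs xs
    ≡⟨ cong₂ _+_ (sumL-cong xs (λ v → if-cong (∧-identityʳ (p v))))
                 (pairSum-biclique xs) ⟩
      sumWhere xs p (λ v → r x + r v) + (cq · Sp xs + cp · Sq xs)
    ≡⟨ cong (_+ (cq · Sp xs + cp · Sq xs)) (sumWhere-+ xs p (r x) r) ⟩
      (cp · r x + Sp xs) + (cq · Sp xs + cp · Sq xs)
    ≡⟨ regroup (cp · r x) (Sp xs) (cq · Sp xs) (cp · Sq xs) ⟩
      (Sp xs + cq · Sp xs) + (cp · r x + cp · Sq xs)
    ≡⟨ cong₂ _+_ (cong (λ s → s + cq · s) (sym (ℚ.+-identityˡ (Sp xs))))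
                 (sym (×-distrib-+ (r x) (Sq xs) cp)) ⟩
      ((0ℚ + Sp xs) + cq · (0ℚ + Sp xs)) + cp · (r x + Sq xs) ∎
    where
    open ≡-Reasoning
    cp = countL xs p
    cq = countL xs q
    regroup : ∀ a s b e → (a + s) + (b + e) ≡ (s + b) + (a + e)
    regroup = solve-∀ ℚ-ring
  ... | false | false = begin
      sumL xs (λ v → if p v ∧ false then r x + r v else 0ℚ) + crossPairs xs
    ≡⟨ cong₂ _+_ (sumL-zero xs (λ v → if-cong (∧-zeroʳ (p v))))
                 (pairSum-biclique xs) ⟩
      0ℚ + (countL xs q · Sp xs + countL xs p · Sq xs)
    ≡⟨ ℚ.+-identityˡ _ ⟩
      countL xs q · Sp xs + countL xs p · Sq xs
    ≡⟨ sym (cong₂ (λ s s′ → countL xs q · s + countL xs p · s′)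
                  (ℚ.+-identityˡ (Sp xs)) (ℚ.+-identityˡ (Sq xs))) ⟩
      countL xs q · (0ℚ + Sp xs) + countL xs p · (0ℚ + Sq xs) ∎
    where open ≡-Reasoning

  pairSum-biclique₁ : ∀ (xs : List A) → countL xs p ≡ 1 → countL xs q ≡ 1 →
                      pairSum xs (λ u v → if across p q u v then r u + r v else 0ℚ)
                      ≡ sumWhere xs p r + sumWhere xs q r
  pairSum-biclique₁ xs cp≡1 cq≡1 =
    trans (pairSum-biclique xs)
          (cong₂ _+_ (trans (cong (_· Sp xs) cq≡1) (×-homo-1 (Sp xs)))
                     (trans (cong (_· Sq xs) cp≡1) (×-homo-1 (Sq xs))))

∈-allSubsets : ∀ {k} (S : Subset k) → S ∈ allSubsets k
∈-allSubsets {zero}  []          = here refl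
∈-allSubsets {suc k} (false ∷ S) = ∈-++⁺ˡ (∈-map⁺ (false ∷_) (∈-allSubsets S))
∈-allSubsets {suc k} (true ∷ S)  =
  ∈-++⁺ʳ (map (false ∷_) (allSubsets k)) (∈-map⁺ (true ∷_) (∈-allSubsets S))

module ForbiddenProperties {n : ℕ} (t : ℕ) (G : Graph n) where
  open Forbidden t G

  isK-adj : ∀ S {u v} → T (isK S) → T (u ∈ᵇ S) → T (v ∈ᵇ S) → u ≢ v → T (adj G u v)
  isK-adj S {u} {v} S-clique u∈S v∈S u≢v =
    T-implies (allL-elim (allL-elim complete (∈-allFin u)) (∈-allFin v))
              (from T-∧ (u∈S , from T-∧ (v∈S , fromWitnessFalse u≢v)))
    where complete = T-∧-tail (∣ S ∣ ≡ᵇ suc t) S-clique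

  module _ (A B : Subset n) (AB-biclique : T (isKtt A B)) where

    private
      disjointᵇ : Bool
      disjointᵇ = allL (allFin n) (λ v → not (v ∈ᵇ A ∧ v ∈ᵇ B))

      disjoint-and-complete : T (disjointᵇ ∧ _)
      disjoint-and-complete = T-∧-tail (∣ B ∣ ≡ᵇ t) (T-∧-tail (∣ A ∣ ≡ᵇ t) AB-biclique)

    isKtt-disjoint : ∀ {v} → T (v ∈ᵇ A) → ¬ T (v ∈ᵇ B)
    isKtt-disjoint {v} v∈A v∈B =
      T-not-¬ (allL-elim (T-∧-head _ disjoint-and-complete) (∈-allFin v)) (from T-∧ (v∈A , v∈B))

    isKtt-adj : ∀ {u v} → T (u ∈ᵇ A) → T (v ∈ᵇ B) → T (adj G u v)
    isKtt-adj {u} {v} u∈A v∈B =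
      T-implies (allL-elim (allL-elim complete (∈-allFin u)) (∈-allFin v)) (from T-∧ (u∈A , v∈B))
      where complete = T-∧-head _ (T-∧-tail disjointᵇ disjoint-and-complete)

module CoveringFromMatching {n : ℕ} (t : ℕ) (G : Graph n)
  (deg≤ : ∀ v → deg G v ≤ suc t)
  (w : Fin n → Fin n → ℚ)
  (w-sym : ∀ u v → T (adj G u v) → w u v ≡ w v u)
  (w≥0 : ∀ u v → T (adj G u v) → 0ℚ ≤ℚ w u v)
  (rK : Subset n → Fin n → ℚ)
  (rK-potential : ∀ S → T (Forbidden.isK t G S) → Forbidden.IsPotentialK t G w S (rK S))
  (rB : Subset n → Subset n → Fin n → ℚ)
  (rB-potential : ∀ A B → T (Forbidden.isKtt t G A B) → Forbidden.IsPotentialB t G w A B (rB A B))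
  (M' : V' n → V' n → Bool)
  (M'-matching : Construction.IsLBMatching t G w rK rB M') where

  open Forbidden t G
  open ForbiddenProperties t G
  open Construction t G w rK rB
  open IsLBMatching M'-matching renaming (sym to M'-sym; sub to M'-sub)

  vertices : List (Fin n)
  vertices = allFin n

  subsets : List (Subset n)
  subsets = allSubsets n

  IsGadget : V' n → Set
  IsGadget (orig _) = ⊥
  IsGadget _        = ⊤

  gadgets : List (V' n)
  gadgets = map uK subsets
         ++ concatMap (λ A → concatMap (λ B → map (uB A B) (allFin 2)) subsets) subsets

  all-gadgets : All IsGadget gadgets
  all-gadgets = ++⁺ (map⁺ (All.universal (λ _ → tt) subsets))
                    (concat⁺ (map⁺ (All.universal (λ A → concat⁺ (map⁺ (All.universal (λ B →
                      map⁺ {f = uB A B} (All.universal (λ _ → tt) (allFin 2))) subsets))) subsets)))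

  gadgets-unlinked : ∀ {x y} → IsGadget x → IsGadget y → ¬ T (M' x y)
  gadgets-unlinked {orig _}               ()
  gadgets-unlinked {uK _}     {orig _}     _ ()
  gadgets-unlinked {uK _}     {uK _}       _ _ = M'-sub _ _
  gadgets-unlinked {uK _}     {uB _ _ _}   _ _ = M'-sub _ _
  gadgets-unlinked {uB _ _ _} {orig _}     _ ()
  gadgets-unlinked {uB _ _ _} {uK _}       _ _ = M'-sub _ _
  gadgets-unlinked {uB _ _ _} {uB _ _ _}   _ _ = M'-sub _ _

  matchedTo : V' n → Fin n → Bool
  matchedTo g u = M' (orig u) g

  gadget-degree : ∀ {g} → IsGadget g → deg' M' g ≡ countL vertices (matchedTo g)
  gadget-degree {g} g-gadget = begin
      countL (map orig vertices ++ gadgets) (M' g)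
    ≡⟨ countL-++-none (map orig vertices) (All.map (gadgets-unlinked g-gadget) all-gadgets) ⟩
      countL (map orig vertices) (M' g)
    ≡⟨ countL-map orig vertices ⟩
      countL vertices (λ u → M' g (orig u))
    ≡⟨ countL-cong vertices (λ u → M'-sym g (orig u)) ⟩
      countL vertices (matchedTo g) ∎
    where open ≡-Reasoning

  degree-pinned : ∀ x {c} → l x ≡ c → b x ≡ c → deg' M' x ≡ c
  degree-pinned x refl b≡l = ℕ.≤-antisym (subst (deg' M' x ≤_) b≡l (upper x)) (lower x)

  matchedK-count : ∀ S → T (isK S) → countL vertices (matchedTo (uK S)) ≡ 2
  matchedK-count S S-forbidden =
    trans (sym (gadget-degree {uK S} _))
          (degree-pinned (uK S) (if-true S-forbidden) (if-true S-forbidden))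

  matchedB-count : ∀ A B → T (isKtt A B) → ∀ i → countL vertices (matchedTo (uB A B i)) ≡ 1
  matchedB-count A B AB-forbidden i =
    trans (sym (gadget-degree {uB A B i} _))
          (degree-pinned (uB A B i) (if-true AB-forbidden) (if-true AB-forbidden))

  matchedK-member : ∀ {S u} → T (matchedTo (uK S) u) → T (isK S) × T (u ∈ᵇ S)
  matchedK-member m = to T-∧ (M'-sub _ _ m)

  matchedB-member : ∀ {A B i u} → T (matchedTo (uB A B i) u) → T (isKtt A B) × T (u ∈ᵇ side A B i)
  matchedB-member m = to T-∧ (M'-sub _ _ m)

  sharesK : Fin n → Fin n → Bool
  sharesK u v = anyL subsets (λ S → matchedTo (uK S) u ∧ matchedTo (uK S) v)

  matchedB₀ matchedB₁ : Subset n → Subset n → Fin n → Bool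
  matchedB₀ A B = matchedTo (uB A B fzero)
  matchedB₁ A B = matchedTo (uB A B (fsuc fzero))

  acrossB : Subset n → Subset n → Fin n → Fin n → Bool
  acrossB A B = across (matchedB₀ A B) (matchedB₁ A B)

  acrossSomeB : Fin n → Fin n → Bool
  acrossSomeB u v = anyL subsets (λ A → anyL subsets (λ B → acrossB A B u v))

  Mbar : Fin n → Fin n → Bool
  Mbar u v = adj G u v ∧ (M' (orig u) (orig v) ∨ sharesK u v ∨ acrossSomeB u v)

  Mbar-sym : ∀ u v → Mbar u v ≡ Mbar v u
  Mbar-sym u v =
    cong₂ _∧_ (adj-sym G u v)
      (cong₂ _∨_ (M'-sym (orig u) (orig v))
        (cong₂ _∨_ (anyL-cong subsets (λ S → ∧-comm (matchedTo (uK S) u) _))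
                   (anyL-cong subsets (λ A → anyL-cong subsets (λ B →
                      across-sym (matchedB₀ A B) (matchedB₁ A B) u v)))))

  Mbar-sharesK : ∀ {S u v} → T (adj G u v) →
                 T (matchedTo (uK S) u) → T (matchedTo (uK S) v) → T (Mbar u v)
  Mbar-sharesK {S} {u} {v} uv mu mv =
    from T-∧ (uv , T-∨-inj₂ (M' (orig u) (orig v))
                    (from T-∨ (inj₁ (anyL-intro (∈-allSubsets S) (from T-∧ (mu , mv))))))

  Mbar-acrossB : ∀ {A B u v} → T (adj G u v) →
                 T (matchedB₀ A B u) → T (matchedB₁ A B v) → T (Mbar u v)
  Mbar-acrossB {A} {B} {u} {v} uv mu mv =
    from T-∧ (uv , T-∨-inj₂ (M' (orig u) (orig v)) (T-∨-inj₂ (sharesK u v)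
      (anyL-intro (∈-allSubsets A)
        (anyL-intro (∈-allSubsets B) (from T-∨ (inj₁ (from T-∧ (mu , mv))))))))

  E∖Mbar : Fin n → Fin n → Bool
  E∖Mbar u v = adj G u v ∧ not (Mbar u v)

  E∖Mbar⊆E : ∀ u v → T (E∖Mbar u v) → T (adj G u v)
  E∖Mbar⊆E u v = T-∧-head (adj G u v)

  Mbar-excluded : ∀ {u v} → T (E∖Mbar u v) → ¬ (T (adj G u v) → T (Mbar u v))
  Mbar-excluded {u} {v} h forced = T-not-¬ (T-∧-tail (adj G u v) h) (forced (E∖Mbar⊆E u v h))

  Mbar-partner : ∀ v x → T (M' (orig v) x) → Σ (Fin n) (λ y → T (adj G v y) × T (Mbar v y))
  Mbar-partner v (orig y) m = y , vy , from T-∧ (vy , from T-∨ (inj₁ m))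
    where vy = M'-sub (orig v) (orig y) m
  Mbar-partner v (uK S) m with matchedK-member m
  ... | S-forbidden , v∈S
    with countL-witness-≢ Fin._≟_ (allFin⁺ n) (ℕ.≤-reflexive (sym (matchedK-count S S-forbidden))) v
  ...   | y , my , y≢v = y , vy , Mbar-sharesK vy m my
    where vy = isK-adj S S-forbidden v∈S (proj₂ (matchedK-member my)) (y≢v ∘ sym)
  Mbar-partner v (uB A B fzero) m with matchedB-member m
  ... | AB-forbidden , v∈A
    with countL-witness vertices (ℕ.≤-reflexive (sym (matchedB-count A B AB-forbidden (fsuc fzero))))
  ...   | y , _ , my = y , vy , Mbar-acrossB vy m my
    where vy = isKtt-adj A B AB-forbidden v∈A (proj₂ (matchedB-member my))
  Mbar-partner v (uB A B (fsuc fzero)) m with matchedB-member m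
  ... | AB-forbidden , v∈B
    with countL-witness vertices (ℕ.≤-reflexive (sym (matchedB-count A B AB-forbidden fzero)))
  ...   | y , _ , my = y , subst T (adj-sym G y v) yv , subst T (Mbar-sym y v) (Mbar-acrossB yv my m)
    where yv = isKtt-adj A B AB-forbidden (proj₂ (matchedB-member my)) v∈B

  saturated-Mbar-edge : ∀ v → deg G v ≡ suc t → Σ (Fin n) (λ y → T (adj G v y) × T (Mbar v y))
  saturated-Mbar-edge v deg≡ with countL-witness (allV' n) l≤deg
    where l≤deg = subst (_≤ deg' M' (orig v)) (if-true (ℕ.≡⇒≡ᵇ _ _ deg≡)) (lower (orig v))
  ... | x , _ , m = Mbar-partner v x m

  Mbar-co-t-matching : ∀ v → countL vertices (E∖Mbar v) ≤ t
  Mbar-co-t-matching v with deg G v ℕ.≟ suc t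
  ... | no deg≢ = ℕ.≤-trans (countL-mono vertices (E∖Mbar⊆E v))
                            (ℕ.≤-pred (ℕ.≤∧≢⇒< (deg≤ v) deg≢))
  ... | yes deg≡ with saturated-Mbar-edge v deg≡
  ...   | y , vy , Mbar-vy = ℕ.≤-pred (subst (countL vertices (E∖Mbar v) <_) deg≡
            (countL-< vertices (E∖Mbar⊆E v) (∈-allFin y)
                      (λ h → Mbar-excluded h (λ _ → Mbar-vy)) vy))

  Mbar-covering : IsCoveringCoTMatching Mbar
  Mbar-covering = record
    { edges  = record { sym = Mbar-sym ; sub = λ u v → T-∧-head (adj G u v) }
    ; tmatch = Mbar-co-t-matching
    ; noK    = no-clique-left
    ; noKtt  = no-biclique-left
    }
    where
    no-clique-left : ∀ S → T (isK S) →
      ¬ (∀ u v → T (u ∈ᵇ S) → T (v ∈ᵇ S) → u ≢ v → T (E∖Mbar u v))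
    no-clique-left S S-forbidden all-left
      with countL-witness vertices (subst (1 ≤_) (sym (matchedK-count S S-forbidden)) (s≤s z≤n))
    ... | x , _ , mx
      with countL-witness-≢ Fin._≟_ (allFin⁺ n) (ℕ.≤-reflexive (sym (matchedK-count S S-forbidden))) x
    ...   | y , my , y≢x =
      Mbar-excluded (all-left x y (proj₂ (matchedK-member mx)) (proj₂ (matchedK-member my)) (y≢x ∘ sym))
                    (λ xy → Mbar-sharesK xy mx my)
    no-biclique-left : ∀ A B → T (isKtt A B) →
      ¬ (∀ u v → T (u ∈ᵇ A) → T (v ∈ᵇ B) → T (E∖Mbar u v))
    no-biclique-left A B AB-forbidden all-left
      with countL-witness vertices (ℕ.≤-reflexive (sym (matchedB-count A B AB-forbidden fzero)))
         | countL-witness vertices (ℕ.≤-reflexive (sym (matchedB-count A B AB-forbidden (fsuc fzero))))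
    ... | x , _ , mx | y , _ , my =
      Mbar-excluded (all-left x y (proj₂ (matchedB-member mx)) (proj₂ (matchedB-member my)))
                    (λ xy → Mbar-acrossB xy mx my)

  -- w extended by 0 off E: nonnegative everywhere, as the union bound in Mbar-pair-≤ requires.
  wE : Fin n → Fin n → ℚ
  wE u v = if adj G u v then w u v else 0ℚ

  wE≥0 : ∀ u v → 0ℚ ≤ℚ wE u v
  wE≥0 u v with adj G u v in uv
  ... | true  = w≥0 u v (from T-≡ uv)
  ... | false = ℚ.≤-refl

  sharesK-weight : ∀ S {u v} → u ≢ v → T (matchedTo (uK S) u) → T (matchedTo (uK S) v) →
                   wE u v ≡ rK S u + rK S v
  sharesK-weight S u≢v mu mv =
    trans (if-true (isK-adj S S-forbidden u∈S v∈S u≢v)) (rK-potential S S-forbidden _ _ u∈S v∈S u≢v)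
    where
    S-forbidden = proj₁ (matchedK-member mu)
    u∈S = proj₂ (matchedK-member mu)
    v∈S = proj₂ (matchedK-member mv)

  acrossB-weight : ∀ A B u v → T (acrossB A B u v) → wE u v ≡ rB A B u + rB A B v
  acrossB-weight A B u v h with across-cases (matchedB₀ A B) (matchedB₁ A B) u v h
  ... | inj₁ (m₀ , m₁) =
    trans (if-true (isKtt-adj A B AB-forbidden u∈A v∈B)) (rB-potential A B AB-forbidden u v u∈A v∈B)
    where
    AB-forbidden = proj₁ (matchedB-member m₀)
    u∈A = proj₂ (matchedB-member m₀)
    v∈B = proj₂ (matchedB-member m₁)
  ... | inj₂ (m₀ , m₁) = begin
      wE u v              ≡⟨ if-true uv ⟩
      w u v               ≡⟨ w-sym u v uv ⟩
      w v u               ≡⟨ rB-potential A B AB-forbidden v u v∈A u∈B ⟩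
      rB A B v + rB A B u ≡⟨ ℚ.+-comm (rB A B v) (rB A B u) ⟩
      rB A B u + rB A B v ∎
    where
    open ≡-Reasoning
    AB-forbidden = proj₁ (matchedB-member m₀)
    v∈A = proj₂ (matchedB-member m₀)
    u∈B = proj₂ (matchedB-member m₁)
    uv = subst T (adj-sym G v u) (isKtt-adj A B AB-forbidden v∈A u∈B)

  Mpair : Fin n → Fin n → ℚ
  Mpair u v = if M' (orig u) (orig v) then w u v else 0ℚ

  Kpair : Subset n → Fin n → Fin n → ℚ
  Kpair S u v = if matchedTo (uK S) u ∧ matchedTo (uK S) v then wE u v else 0ℚ

  Bpair : Subset n → Subset n → Fin n → Fin n → ℚ
  Bpair A B u v = if acrossB A B u v then wE u v else 0ℚ

  Gpair : Fin n → Fin n → ℚ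
  Gpair u v = sumL subsets (λ S → Kpair S u v)
            + sumL subsets (λ A → sumL subsets (λ B → Bpair A B u v))

  Mbar-pair-≤ : ∀ u v → (if Mbar u v then w u v else 0ℚ) ≤ℚ Mpair u v + Gpair u v
  Mbar-pair-≤ u v = begin
      (if adj G u v ∧ (viaM ∨ viaK ∨ viaB) then w u v else 0ℚ)
    ≡⟨ restrict-to-edges (viaM ∨ viaK ∨ viaB) ⟩
      (if viaM ∨ viaK ∨ viaB then wE u v else 0ℚ)
    ≤⟨ if-∨-≤ viaM (viaK ∨ viaB) (wE≥0 u v) ⟩
      [ viaM ] + (if viaK ∨ viaB then wE u v else 0ℚ)
    ≤⟨ ℚ.+-monoʳ-≤ [ viaM ] (if-∨-≤ viaK viaB (wE≥0 u v)) ⟩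
      [ viaM ] + ([ viaK ] + [ viaB ])
    ≤⟨ ℚ.+-monoʳ-≤ [ viaM ] (ℚ.+-mono-≤ (if-anyL-≤ subsets _ (wE≥0 u v))
         (ℚ.≤-trans (if-anyL-≤ subsets _ (wE≥0 u v))
                    (sumL-mono subsets (λ A → if-anyL-≤ subsets _ (wE≥0 u v))))) ⟩
      [ viaM ] + Gpair u v
    ≡⟨ cong (_+ Gpair u v) (if-then-cong viaM (λ uv → if-true (M'-sub (orig u) (orig v) uv))) ⟩
      Mpair u v + Gpair u v ∎
    where
    open ℚ.≤-Reasoning
    viaM = M' (orig u) (orig v)
    viaK = sharesK u v
    viaB = acrossSomeB u v
    [_] : Bool → ℚ
    [ β ] = if β then wE u v else 0ℚ
    restrict-to-edges : ∀ β → (if adj G u v ∧ β then w u v else 0ℚ) ≡ [ β ]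
    restrict-to-edges β with adj G u v
    ... | true  = refl
    ... | false = sym (if-eta β)

  weightAt : V' n → ℚ
  weightAt g = sumL vertices (λ u → if M' (orig u) g then w' (orig u) g else 0ℚ)

  weightAt-unmatched : ∀ g → (∀ u → ¬ T (matchedTo g u)) → weightAt g ≡ 0ℚ
  weightAt-unmatched g unmatched = sumL-zero vertices (λ u → if-false (unmatched u))

  Kpairs-weight : ∀ S → pairSum vertices (Kpair S) ≡ weightAt (uK S)
  Kpairs-weight S with T? (isK S)
  ... | yes S-forbidden = begin
      pairSum vertices (Kpair S)
    ≡⟨ pairSum-cong (allFin⁺ n) (λ u v u≢v → if-then-cong (matched u ∧ matched v) λ h →
         sharesK-weight S u≢v (T-∧-head (matched u) h) (T-∧-tail (matched u) h)) ⟩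
      pairSum vertices (λ u v → if matched u ∧ matched v then rK S u + rK S v else 0ℚ)
    ≡⟨ pairSum-clique₂ matched (rK S) vertices (matchedK-count S S-forbidden) ⟩
      weightAt (uK S) ∎
    where
    open ≡-Reasoning
    matched = matchedTo (uK S)
  ... | no S-free =
    trans (pairSum-zero (All.universal unmatched vertices) (λ ¬mu _ → if-false (¬mu ∘ T-∧-head _)))
          (sym (weightAt-unmatched (uK S) unmatched))
    where
    unmatched : ∀ u → ¬ T (matchedTo (uK S) u)
    unmatched u = S-free ∘ proj₁ ∘ matchedK-member

  Bpairs-weight : ∀ A B →
                  pairSum vertices (Bpair A B) ≡ sumL (allFin 2) (λ i → weightAt (uB A B i))
  Bpairs-weight A B with T? (isKtt A B)
  ... | yes AB-forbidden = begin
      pairSum vertices (Bpair A B)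
    ≡⟨ pairSum-cong (allFin⁺ n) (λ u v _ → if-then-cong (acrossB A B u v) (acrossB-weight A B u v)) ⟩
      pairSum vertices (λ u v → if acrossB A B u v then rB A B u + rB A B v else 0ℚ)
    ≡⟨ pairSum-biclique₁ (matchedB₀ A B) (matchedB₁ A B) (rB A B) sides-disjoint vertices
         (matchedB-count A B AB-forbidden fzero) (matchedB-count A B AB-forbidden (fsuc fzero)) ⟩
      weightAt (uB A B fzero) + weightAt (uB A B (fsuc fzero))
    ≡⟨ cong (weightAt (uB A B fzero) +_) (sym (ℚ.+-identityʳ _)) ⟩
      sumL (allFin 2) (λ i → weightAt (uB A B i)) ∎
    where
    open ≡-Reasoning
    sides-disjoint : ∀ u → T (matchedB₀ A B u) → ¬ T (matchedB₁ A B u)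
    sides-disjoint u m₀ m₁ =
      isKtt-disjoint A B AB-forbidden (proj₂ (matchedB-member m₀)) (proj₂ (matchedB-member m₁))
  ... | no AB-free =
    trans (pairSum-zero (All.universal (unmatched fzero) vertices) across-none)
          (sym (cong₂ _+_ (weightAt-unmatched _ (unmatched fzero))
                          (cong (_+ 0ℚ) (weightAt-unmatched _ (unmatched (fsuc fzero))))))
    where
    unmatched : ∀ i u → ¬ T (matchedTo (uB A B i) u)
    unmatched i u = AB-free ∘ proj₁ ∘ matchedB-member
    across-none : ∀ {u v} → ¬ T (matchedB₀ A B u) → ¬ T (matchedB₀ A B v) → Bpair A B u v ≡ 0ℚ
    across-none {u} {v} ¬m₀u ¬m₀v = if-false λ h →
      [ ¬m₀u ∘ proj₁ , ¬m₀v ∘ proj₁ ]′ (across-cases (matchedB₀ A B) (matchedB₁ A B) u v h)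

  gadgets-weight : sumL gadgets weightAt
                   ≡ sumL subsets (λ S → weightAt (uK S))
                     + sumL subsets (λ A → sumL subsets (λ B → sumL (allFin 2) (λ i → weightAt (uB A B i))))
  gadgets-weight =
    trans (sumL-++ (map uK subsets) _ weightAt)
      (cong₂ _+_ (sumL-map uK subsets weightAt)
        (trans (sumL-concatMap _ subsets weightAt)
          (sumL-cong subsets (λ A → trans (sumL-concatMap _ subsets weightAt)
            (sumL-cong subsets (λ B → sumL-map (uB A B) (allFin 2) weightAt))))))

  weight'-split : weight' M' ≡ pairSum vertices Mpair + sumL gadgets weightAt
  weight'-split = begin
      pairSum (map orig vertices ++ gadgets) f
    ≡⟨ pairSum-++ (map orig vertices) gadgets f ⟩
      pairSum (map orig vertices) f
        + (sumL (map orig vertices) (λ x → sumL gadgets (f x)) + pairSum gadgets f)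
    ≡⟨ cong₂ _+_ (pairSum-map orig vertices f)
         (cong₂ _+_ (trans (sumL-map orig vertices _) (sumL-swap vertices gadgets (λ u → f (orig u))))
                    (pairSum-zero all-gadgets (λ gx gy → if-false (gadgets-unlinked gx gy)))) ⟩
      pairSum vertices Mpair + (sumL gadgets weightAt + 0ℚ)
    ≡⟨ cong (pairSum vertices Mpair +_) (ℚ.+-identityʳ _) ⟩
      pairSum vertices Mpair + sumL gadgets weightAt ∎
    where
    open ≡-Reasoning
    f : V' n → V' n → ℚ
    f x y = if M' x y then w' x y else 0ℚ

  Gpairs-weight : pairSum vertices Gpair ≡ sumL gadgets weightAt
  Gpairs-weight = begin
      pairSum vertices Gpair
    ≡⟨ pairSum-+ vertices _ _ ⟩
      pairSum vertices (λ u v → sumL subsets (λ S → Kpair S u v))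
        + pairSum vertices (λ u v → sumL subsets (λ A → sumL subsets (λ B → Bpair A B u v)))
    ≡⟨ cong₂ _+_ (pairSum-sumL vertices subsets Kpair)
         (trans (pairSum-sumL vertices subsets (λ A u v → sumL subsets (λ B → Bpair A B u v)))
                (sumL-cong subsets (λ A → pairSum-sumL vertices subsets (Bpair A)))) ⟩
      sumL subsets (λ S → pairSum vertices (Kpair S))
        + sumL subsets (λ A → sumL subsets (λ B → pairSum vertices (Bpair A B)))
    ≡⟨ cong₂ _+_ (sumL-cong subsets Kpairs-weight)
                 (sumL-cong subsets (λ A → sumL-cong subsets (Bpairs-weight A))) ⟩
      sumL subsets (λ S → weightAt (uK S))
        + sumL subsets (λ A → sumL subsets (λ B → sumL (allFin 2) (λ i → weightAt (uB A B i))))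
    ≡⟨ sym gadgets-weight ⟩
      sumL gadgets weightAt ∎
    where open ≡-Reasoning

  Mbar-weight-≤ : weight w Mbar ≤ℚ weight' M'
  Mbar-weight-≤ = begin
      weight w Mbar
    ≤⟨ pairSum-mono vertices Mbar-pair-≤ ⟩
      pairSum vertices (λ u v → Mpair u v + Gpair u v)
    ≡⟨ pairSum-+ vertices Mpair Gpair ⟩
      pairSum vertices Mpair + pairSum vertices Gpair
    ≡⟨ cong (pairSum vertices Mpair +_) Gpairs-weight ⟩
      pairSum vertices Mpair + sumL gadgets weightAt
    ≡⟨ sym weight'-split ⟩
      weight' M' ∎
    where open ℚ.≤-Reasoning

theorem3 : (t n : ℕ) → 3 ≤ t → (G : Graph n) →
    (∀ v → 1 ≤ deg G v × deg G v ≤ suc t) →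
    (w : Fin n → Fin n → ℚ) →
    (∀ u v → T (adj G u v) → w u v ≡ w v u) →
    (∀ u v → T (adj G u v) → 0ℚ ≤ℚ w u v) →
    (rK : Subset n → Fin n → ℚ) →
    (∀ S → T (Forbidden.isK t G S) → Forbidden.IsPotentialK t G w S (rK S)) →
    (rB : Subset n → Subset n → Fin n → ℚ) →
    (∀ A B → T (Forbidden.isKtt t G A B) → Forbidden.IsPotentialB t G w A B (rB A B)) →
    Forbidden.PairwiseDisjoint t G →
    (M' : V' n → V' n → Bool) →
    Construction.IsLBMatching t G w rK rB M' →
    Σ (Fin n → Fin n → Bool) (λ Mbar →
      Forbidden.IsCoveringCoTMatching t G Mbar ×
      weight w Mbar ≤ℚ Construction.weight' t G w rK rB M')
theorem3 t n _ G degrees w w-sym w≥0 rK rK-potential rB rB-potential _ M' M'-matching =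
  Mbar , Mbar-covering , Mbar-weight-≤
  where
  open CoveringFromMatching t G (proj₂ ∘ degrees) w w-sym w≥0 rK rK-potential rB rB-potential
                            M' M'-matching
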